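{- Let $p$ be a prime with $p \equiv 7$ or $23 \pmod{40}$. Then there is no triple $(N,M,e) \in \mathbb{Z}^3$ with $M \neq 0$, $e \neq 0$ satisfying $N^2 = 2M^4 + 10pe^4$ together with $\gcd(N,e)=\gcd(M,e)=\gcd(2,e)=\gcd(10p,M)=\gcd(M,N)=1$. -}

module Defs where

-- Reduce modulo 5. Since 5 ∣ 10p, the equation gives N² ≡ 2M⁴ (mod 5), and
-- gcd(10p, M) = 1 makes M a unit mod 5, so M⁴ ≡ 1 by Fermat and N² ≡ 2.
-- But 2 is not a square mod 5.
module Submission where

open import Defs
open import Data.Nat using (ℕ; _%_)
open import Data.Nat.Primality using (Prime)
open import Data.Integer using (ℤ; +_; _+_; _*_; _^_)
open import Data.Integer.GCD using (gcd)
open import Data.Product using (Σ; _×_)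
open import Data.Sum using (_⊎_)
open import Relation.Binary.PropositionalEquality using (_≡_; _≢_)
open import Relation.Nullary using (¬_)

open import Data.Nat using (zero; suc; _<_; s≤s)
open import Data.Product using (_,_)
open import Data.Integer using (∣_∣; -[1+_])
open import Data.Nat.DivMod using (m%n%n≡m%n; [m+kn]%n≡m%n; %-distribˡ-*; m%n<n)
open import Data.Nat.Divisibility using (_∣_; divides; ∣-trans; m∣m*n; m%n≡0⇒n∣m)
open import Data.Nat.Coprimality using (gcd≡1⇒coprime)
open import Relation.Binary.PropositionalEquality using (refl; sym; trans; cong; cong₂; module ≡-Reasoning)
import Data.Nat as ℕ
import Data.Nat.Properties as ℕ
import Data.Nat.GCD as ℕ
import Data.Integer.Properties as ℤ

%-distribˡ-^ : ∀ m n d .{{_ : ℕ.NonZero d}} → (m ℕ.^ n) % d ≡ ((m % d) ℕ.^ n) % d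
%-distribˡ-^ m zero    d = refl
%-distribˡ-^ m (suc n) d = begin
  (m ℕ.* m ℕ.^ n) % d                         ≡⟨ %-distribˡ-* m (m ℕ.^ n) d ⟩
  ((m % d) ℕ.* ((m ℕ.^ n) % d)) % d           ≡⟨ cong (λ x → ((m % d) ℕ.* x) % d) (%-distribˡ-^ m n d) ⟩
  ((m % d) ℕ.* (((m % d) ℕ.^ n) % d)) % d     ≡⟨ cong (λ x → (x ℕ.* (((m % d) ℕ.^ n) % d)) % d) (sym (m%n%n≡m%n m d)) ⟩
  ((m % d % d) ℕ.* (((m % d) ℕ.^ n) % d)) % d ≡⟨ sym (%-distribˡ-* (m % d) ((m % d) ℕ.^ n) d) ⟩
  ((m % d) ℕ.* (m % d) ℕ.^ n) % d             ∎
  where open ≡-Reasoning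

square-mod-5≢2 : ∀ n → (n ℕ.^ 2) % 5 ≢ 2
square-mod-5≢2 n n²%5≡2 = residue (n % 5) (m%n<n n 5) (trans (sym (%-distribˡ-^ n 2 5)) n²%5≡2)
  where
  residue : ∀ r → r < 5 → (r ℕ.^ 2) % 5 ≢ 2
  residue 0 _ ()
  residue 1 _ ()
  residue 2 _ ()
  residue 3 _ ()
  residue 4 _ ()
  residue (suc (suc (suc (suc (suc _))))) (s≤s (s≤s (s≤s (s≤s (s≤s ()))))) _

fermat-5 : ∀ m → ¬ 5 ∣ m → (m ℕ.^ 4) % 5 ≡ 1
fermat-5 m 5∤m = trans (%-distribˡ-^ m 4 5) (residue (m % 5) (m%n<n m 5) (λ m%5≡0 → 5∤m (m%n≡0⇒n∣m m 5 m%5≡0)))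
  where
  residue : ∀ r → r < 5 → r ≢ 0 → (r ℕ.^ 4) % 5 ≡ 1
  residue 0 _ r≢0 with () ← r≢0 refl
  residue 1 _ _ = refl
  residue 2 _ _ = refl
  residue 3 _ _ = refl
  residue 4 _ _ = refl
  residue (suc (suc (suc (suc (suc _))))) (s≤s (s≤s (s≤s (s≤s (s≤s ()))))) _

no-solution-mod-5 : ∀ n m c → ¬ 5 ∣ m → n ℕ.^ 2 ≢ 2 ℕ.* m ℕ.^ 4 ℕ.+ 5 ℕ.* c
no-solution-mod-5 n m c 5∤m eq = square-mod-5≢2 n (begin
  (n ℕ.^ 2) % 5                         ≡⟨ cong (_% 5) eq ⟩
  (2 ℕ.* m ℕ.^ 4 ℕ.+ 5 ℕ.* c) % 5       ≡⟨ cong (λ x → (2 ℕ.* m ℕ.^ 4 ℕ.+ x) % 5) (ℕ.*-comm 5 c) ⟩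
  (2 ℕ.* m ℕ.^ 4 ℕ.+ c ℕ.* 5) % 5       ≡⟨ [m+kn]%n≡m%n (2 ℕ.* m ℕ.^ 4) c 5 ⟩
  (2 ℕ.* m ℕ.^ 4) % 5                   ≡⟨ %-distribˡ-* 2 (m ℕ.^ 4) 5 ⟩
  (2 ℕ.* ((m ℕ.^ 4) % 5)) % 5           ≡⟨ cong (λ x → (2 ℕ.* x) % 5) (fermat-5 m 5∤m) ⟩
  2                                     ∎)
  where open ≡-Reasoning

i*i≡∣i∣*∣i∣ : ∀ i → i * i ≡ + (∣ i ∣ ℕ.* ∣ i ∣)
i*i≡∣i∣*∣i∣ (+ n)    = sym (ℤ.pos-* n n)
i*i≡∣i∣*∣i∣ -[1+ n ] = refl

pos-^ : ∀ m n → (+ m) ^ n ≡ + (m ℕ.^ n)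
pos-^ m zero    = refl
pos-^ m (suc n) = trans (cong (+ m *_) (pos-^ m n)) (sym (ℤ.pos-* m (m ℕ.^ n)))

i^[2k]≡∣i∣^[2k] : ∀ i k → i ^ (2 ℕ.* k) ≡ + (∣ i ∣ ℕ.^ (2 ℕ.* k))
i^[2k]≡∣i∣^[2k] i k = begin
  i ^ (2 ℕ.* k)                   ≡⟨ sym (ℤ.^-*-assoc i 2 k) ⟩
  (i ^ 2) ^ k                     ≡⟨ cong (λ x → (i * x) ^ k) (ℤ.*-identityʳ i) ⟩
  (i * i) ^ k                     ≡⟨ cong (_^ k) (i*i≡∣i∣*∣i∣ i) ⟩
  (+ (∣ i ∣ ℕ.* ∣ i ∣)) ^ k       ≡⟨ cong (λ x → (+ (∣ i ∣ ℕ.* x)) ^ k) (sym (ℕ.*-identityʳ ∣ i ∣)) ⟩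
  (+ (∣ i ∣ ℕ.^ 2)) ^ k           ≡⟨ pos-^ (∣ i ∣ ℕ.^ 2) k ⟩
  + ((∣ i ∣ ℕ.^ 2) ℕ.^ k)         ≡⟨ cong +_ (ℕ.^-*-assoc ∣ i ∣ 2 k) ⟩
  + (∣ i ∣ ℕ.^ (2 ℕ.* k))         ∎
  where open ≡-Reasoning

equation-on-∣∣ : ∀ p N M e → N ^ 2 ≡ + 2 * M ^ 4 + + 10 * + p * e ^ 4 →
  ∣ N ∣ ℕ.^ 2 ≡ 2 ℕ.* ∣ M ∣ ℕ.^ 4 ℕ.+ 5 ℕ.* (2 ℕ.* (p ℕ.* ∣ e ∣ ℕ.^ 4))
equation-on-∣∣ p N M e eq = ℤ.+-injective (begin
  + (n ℕ.^ 2)                                      ≡⟨ sym (i^[2k]≡∣i∣^[2k] N 1) ⟩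
  N ^ 2                                            ≡⟨ eq ⟩
  + 2 * M ^ 4 + + 10 * + p * e ^ 4                 ≡⟨ cong₂ (λ x y → + 2 * x + + 10 * + p * y) (i^[2k]≡∣i∣^[2k] M 2) (i^[2k]≡∣i∣^[2k] e 2) ⟩
  + 2 * + (m ℕ.^ 4) + + 10 * + p * + (k ℕ.^ 4)     ≡⟨ cong₂ _+_ (sym (ℤ.pos-* 2 (m ℕ.^ 4))) pos-10pk⁴ ⟩
  + (2 ℕ.* m ℕ.^ 4) + + (10 ℕ.* p ℕ.* k ℕ.^ 4)     ≡⟨ sym (ℤ.pos-+ (2 ℕ.* m ℕ.^ 4) (10 ℕ.* p ℕ.* k ℕ.^ 4)) ⟩
  + (2 ℕ.* m ℕ.^ 4 ℕ.+ 10 ℕ.* p ℕ.* k ℕ.^ 4)       ≡⟨ cong (λ x → + (2 ℕ.* m ℕ.^ 4 ℕ.+ x)) 10pk⁴≡5·2pk⁴ ⟩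
  + (2 ℕ.* m ℕ.^ 4 ℕ.+ 5 ℕ.* (2 ℕ.* (p ℕ.* k ℕ.^ 4))) ∎)
  where
  open ≡-Reasoning
  n = ∣ N ∣
  m = ∣ M ∣
  k = ∣ e ∣
  pos-10pk⁴ : + 10 * + p * + (k ℕ.^ 4) ≡ + (10 ℕ.* p ℕ.* k ℕ.^ 4)
  pos-10pk⁴ = trans (cong (_* + (k ℕ.^ 4)) (sym (ℤ.pos-* 10 p))) (sym (ℤ.pos-* (10 ℕ.* p) (k ℕ.^ 4)))
  10pk⁴≡5·2pk⁴ : 10 ℕ.* p ℕ.* k ℕ.^ 4 ≡ 5 ℕ.* (2 ℕ.* (p ℕ.* k ℕ.^ 4))
  10pk⁴≡5·2pk⁴ = trans (ℕ.*-assoc 10 p (k ℕ.^ 4)) (ℕ.*-assoc 5 2 (p ℕ.* k ℕ.^ 4))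

coprime-to-10p⇒5∤ : ∀ p M → gcd (+ 10 * + p) M ≡ + 1 → ¬ 5 ∣ ∣ M ∣
coprime-to-10p⇒5∤ p M gcd≡1 5∣M = 5≢1 (gcd≡1⇒coprime gcd[10p,M]≡1 (5∣10p , 5∣M))
  where
  gcd[10p,M]≡1 : ℕ.gcd (10 ℕ.* p) ∣ M ∣ ≡ 1
  gcd[10p,M]≡1 = trans (cong (λ x → ℕ.gcd x ∣ M ∣) (sym (ℤ.abs-* (+ 10) (+ p)))) (ℤ.+-injective gcd≡1)
  5∣10p : 5 ∣ 10 ℕ.* p
  5∣10p = ∣-trans (divides 2 refl) (m∣m*n p)
  5≢1 : 5 ≢ 1
  5≢1 ()

lemma3p4 : (p : ℕ) → Prime p → (p % 40 ≡ 7 ⊎ p % 40 ≡ 23) →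
    ¬ (Σ ℤ λ N → Σ ℤ λ M → Σ ℤ λ e →
        M ≢ + 0 × e ≢ + 0 ×
        N ^ 2 ≡ + 2 * M ^ 4 + + 10 * + p * e ^ 4 ×
        gcd N e ≡ + 1 × gcd M e ≡ + 1 × gcd (+ 2) e ≡ + 1 ×
        gcd (+ 10 * + p) M ≡ + 1 × gcd M N ≡ + 1)
lemma3p4 p _ _ (N , M , e , _ , _ , eq , _ , _ , _ , gcd[10p,M]≡1 , _) =
  no-solution-mod-5 ∣ N ∣ ∣ M ∣ (2 ℕ.* (p ℕ.* ∣ e ∣ ℕ.^ 4))
    (coprime-to-10p⇒5∤ p M gcd[10p,M]≡1)
    (equation-on-∣∣ p N M e eq)
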